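{- For every term $M\in[\sigma]_{\mathrm O}$ and every normal form $N\in[\sigma]$, the set $S_{M,N}=\{\omega\in\mathbb{B}^{\mathbb{N}}\mid M^\omega\Downarrow N\}$ is measurable.
   Context: Consider a PCF-style (typed, deterministic, call-by-name or call-by-value) programming language with base types $\mathrm{nat},\mathrm{bool}$ and type constructors $\to,\times$; let $\mathrm O=\mathrm{nat}\to\mathrm{bool}$ be the type of oracles. $[\sigma]$ denotes the set of closed terms of type $\sigma$, and $[\sigma]_{\mathrm O}$ the set of terms of type $\sigma$ whose only free variable is a fixed variable $o$ of type $\mathrm O$. For $M\in[\sigma]_{\mathrm O}$ and $\omega\in\mathbb{B}^{\mathbb{N}}$ ($\mathbb{B}=\{0,1\}$), $M^\omega\in[\sigma]$ is the closed program in which every call $o\,\overline n$ is answered by the boolean $\omega(n)$. $M\Downarrow N$ means $M$ reduces (in finitely many steps) to the normal form $N$. Measurability refers to the $\sigma$-algebra on $\mathbb{B}^{\mathbb{N}}$ generated by cylinders (sets of sequences with prescribed values at finitely many positions). -}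

module Defs where

open import Data.Nat using (ℕ; zero; suc)
open import Data.Bool using (Bool; true; false)
open import Data.Product using (Σ; _×_; _,_)
open import Data.List using (List; []; _∷_)
open import Data.List.Relation.Unary.All using (All)
open import Relation.Binary.PropositionalEquality using (_≡_)
open import Relation.Nullary using (¬_)
open import Function.Bundles using (_⇔_)

infixr 7 _⇒_
data Ty : Set where
  nat  : Ty
  bool : Ty
  _⇒_  : Ty → Ty → Ty
  _⊗_  : Ty → Ty → Ty

O : Ty
O = nat ⇒ bool

Ctx : Set
Ctx = List Ty

data _∋_ : Ctx → Ty → Set where
  here  : ∀ {Γ σ} → (σ ∷ Γ) ∋ σ
  there : ∀ {Γ σ τ} → Γ ∋ σ → (τ ∷ Γ) ∋ σ

-- PCF terms (intrinsically typed, de Bruijn), extended with oracle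
-- constants ⟪ ω ⟫ : O, which are used only to interpret M^ω.

data Tm (Γ : Ctx) : Ty → Set where
  var    : ∀ {σ} → Γ ∋ σ → Tm Γ σ
  lam    : ∀ {σ τ} → Tm (σ ∷ Γ) τ → Tm Γ (σ ⇒ τ)
  app    : ∀ {σ τ} → Tm Γ (σ ⇒ τ) → Tm Γ σ → Tm Γ τ
  pair   : ∀ {σ τ} → Tm Γ σ → Tm Γ τ → Tm Γ (σ ⊗ τ)
  fst    : ∀ {σ τ} → Tm Γ (σ ⊗ τ) → Tm Γ σ
  snd    : ∀ {σ τ} → Tm Γ (σ ⊗ τ) → Tm Γ τ
  zer    : Tm Γ nat
  succ   : Tm Γ nat → Tm Γ nat
  pred   : Tm Γ nat → Tm Γ nat
  iszero : Tm Γ nat → Tm Γ bool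
  tt     : Tm Γ bool
  ff     : Tm Γ bool
  ifte   : ∀ {σ} → Tm Γ bool → Tm Γ σ → Tm Γ σ → Tm Γ σ
  fix    : ∀ {σ} → Tm Γ (σ ⇒ σ) → Tm Γ σ
  ⟪_⟫    : (ℕ → Bool) → Tm Γ O

num : ∀ {Γ} → ℕ → Tm Γ nat
num zero    = zer
num (suc n) = succ (num n)

bconst : ∀ {Γ} → Bool → Tm Γ bool
bconst true  = tt
bconst false = ff

data Pure {Γ : Ctx} : ∀ {σ} → Tm Γ σ → Set where
  var    : ∀ {σ} (x : Γ ∋ σ) → Pure (var x)
  lam    : ∀ {σ τ} {M : Tm (σ ∷ Γ) τ} → Pure M → Pure (lam M)
  app    : ∀ {σ τ} {M : Tm Γ (σ ⇒ τ)} {N} → Pure M → Pure N → Pure (app M N)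
  pair   : ∀ {σ τ} {M : Tm Γ σ} {N : Tm Γ τ} → Pure M → Pure N → Pure (pair M N)
  fst    : ∀ {σ τ} {M : Tm Γ (σ ⊗ τ)} → Pure M → Pure (fst M)
  snd    : ∀ {σ τ} {M : Tm Γ (σ ⊗ τ)} → Pure M → Pure (snd M)
  zer    : Pure zer
  succ   : ∀ {M} → Pure M → Pure (succ M)
  pred   : ∀ {M} → Pure M → Pure (pred M)
  iszero : ∀ {M} → Pure M → Pure (iszero M)
  tt     : Pure tt
  ff     : Pure ff
  ifte   : ∀ {σ} {B} {M N : Tm Γ σ} → Pure B → Pure M → Pure N → Pure (ifte B M N)
  fix    : ∀ {σ} {M : Tm Γ (σ ⇒ σ)} → Pure M → Pure (fix M)

Ren : Ctx → Ctx → Set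
Ren Γ Δ = ∀ {σ} → Γ ∋ σ → Δ ∋ σ

extR : ∀ {Γ Δ τ} → Ren Γ Δ → Ren (τ ∷ Γ) (τ ∷ Δ)
extR ρ here      = here
extR ρ (there x) = there (ρ x)

rename : ∀ {Γ Δ σ} → Ren Γ Δ → Tm Γ σ → Tm Δ σ
rename ρ (var x)      = var (ρ x)
rename ρ (lam M)      = lam (rename (extR ρ) M)
rename ρ (app M N)    = app (rename ρ M) (rename ρ N)
rename ρ (pair M N)   = pair (rename ρ M) (rename ρ N)
rename ρ (fst M)      = fst (rename ρ M)
rename ρ (snd M)      = snd (rename ρ M)
rename ρ zer          = zer
rename ρ (succ M)     = succ (rename ρ M)
rename ρ (pred M)     = pred (rename ρ M)
rename ρ (iszero M)   = iszero (rename ρ M)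
rename ρ tt           = tt
rename ρ ff           = ff
rename ρ (ifte B M N) = ifte (rename ρ B) (rename ρ M) (rename ρ N)
rename ρ (fix M)      = fix (rename ρ M)
rename ρ ⟪ ω ⟫        = ⟪ ω ⟫

Sub : Ctx → Ctx → Set
Sub Γ Δ = ∀ {σ} → Γ ∋ σ → Tm Δ σ

extS : ∀ {Γ Δ τ} → Sub Γ Δ → Sub (τ ∷ Γ) (τ ∷ Δ)
extS s here      = var here
extS s (there x) = rename there (s x)

subst : ∀ {Γ Δ σ} → Sub Γ Δ → Tm Γ σ → Tm Δ σ
subst s (var x)      = s x
subst s (lam M)      = lam (subst (extS s) M)
subst s (app M N)    = app (subst s M) (subst s N)
subst s (pair M N)   = pair (subst s M) (subst s N)
subst s (fst M)      = fst (subst s M)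
subst s (snd M)      = snd (subst s M)
subst s zer          = zer
subst s (succ M)     = succ (subst s M)
subst s (pred M)     = pred (subst s M)
subst s (iszero M)   = iszero (subst s M)
subst s tt           = tt
subst s ff           = ff
subst s (ifte B M N) = ifte (subst s B) (subst s M) (subst s N)
subst s (fix M)      = fix (subst s M)
subst s ⟪ ω ⟫        = ⟪ ω ⟫

single : ∀ {Γ τ} → Tm Γ τ → Sub (τ ∷ Γ) Γ
single N here      = N
single N (there x) = var x

_[_] : ∀ {Γ σ τ} → Tm (τ ∷ Γ) σ → Tm Γ τ → Tm Γ σ
M [ N ] = subst (single N) M

record Closed (σ : Ty) : Set where
  constructor closed
  field
    term : Tm [] σ
    pure : Pure term

-- [σ]_O : PCF terms whose only free variable is o : O
record OTerm (σ : Ty) : Set where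
  constructor oterm
  field
    term : Tm (O ∷ []) σ
    pure : Pure term

_^_ : ∀ {σ} → OTerm σ → (ℕ → Bool) → Tm [] σ
M ^ ω = OTerm.term M [ ⟪ ω ⟫ ]

data IsNum {Γ : Ctx} : Tm Γ nat → Set where
  zer  : IsNum zer
  succ : ∀ {M} → IsNum M → IsNum (succ M)

infix 4 _⟶_
data _⟶_ {Γ : Ctx} : ∀ {σ} → Tm Γ σ → Tm Γ σ → Set where
  β        : ∀ {σ τ} {M : Tm (σ ∷ Γ) τ} {N} → app (lam M) N ⟶ M [ N ]
  ξ-app    : ∀ {σ τ} {M M' : Tm Γ (σ ⇒ τ)} {N} → M ⟶ M' → app M N ⟶ app M' N
  oracle   : ∀ {ω n} → app ⟪ ω ⟫ (num n) ⟶ bconst (ω n)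
  ξ-oracle : ∀ {ω N N'} → N ⟶ N' → app ⟪ ω ⟫ N ⟶ app ⟪ ω ⟫ N'
  fst-β    : ∀ {σ τ} {M : Tm Γ σ} {N : Tm Γ τ} → fst (pair M N) ⟶ M
  ξ-fst    : ∀ {σ τ} {M M' : Tm Γ (σ ⊗ τ)} → M ⟶ M' → fst M ⟶ fst M'
  snd-β    : ∀ {σ τ} {M : Tm Γ σ} {N : Tm Γ τ} → snd (pair M N) ⟶ N
  ξ-snd    : ∀ {σ τ} {M M' : Tm Γ (σ ⊗ τ)} → M ⟶ M' → snd M ⟶ snd M'
  ξ-succ   : ∀ {M M'} → M ⟶ M' → succ M ⟶ succ M'
  pred-0   : pred zer ⟶ zer
  pred-s   : ∀ {V} → IsNum V → pred (succ V) ⟶ V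
  ξ-pred   : ∀ {M M'} → M ⟶ M' → pred M ⟶ pred M'
  isz-0    : iszero zer ⟶ tt
  isz-s    : ∀ {V} → IsNum V → iszero (succ V) ⟶ ff
  ξ-isz    : ∀ {M M'} → M ⟶ M' → iszero M ⟶ iszero M'
  if-t     : ∀ {σ} {M N : Tm Γ σ} → ifte tt M N ⟶ M
  if-f     : ∀ {σ} {M N : Tm Γ σ} → ifte ff M N ⟶ N
  ξ-if     : ∀ {σ} {B B'} {M N : Tm Γ σ} → B ⟶ B' → ifte B M N ⟶ ifte B' M N
  fix-β    : ∀ {σ} {M : Tm Γ (σ ⇒ σ)} → fix M ⟶ app M (fix M)

infix 4 _⟶*_
data _⟶*_ {Γ : Ctx} {σ : Ty} : Tm Γ σ → Tm Γ σ → Set where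
  done : ∀ {M} → M ⟶* M
  step : ∀ {M M' M''} → M ⟶ M' → M' ⟶* M'' → M ⟶* M''

data NormalForm {Γ : Ctx} : ∀ {σ} → Tm Γ σ → Set where
  numeral : ∀ {V} → IsNum V → NormalForm V
  tt     : NormalForm tt
  ff     : NormalForm ff
  lam    : ∀ {σ τ} {M : Tm (σ ∷ Γ) τ} → NormalForm (lam M)
  pair   : ∀ {σ τ} {M : Tm Γ σ} {N : Tm Γ τ} → NormalForm (pair M N)
  oracle : ∀ {ω} → NormalForm ⟪ ω ⟫

infix 4 _⇓_
_⇓_ : ∀ {σ} → Tm [] σ → Tm [] σ → Set
M ⇓ N = (M ⟶* N) × NormalForm N

Cantor : Set
Cantor = ℕ → Bool

Subset : Set₁
Subset = Cantor → Set

Cylinder : List (ℕ × Bool) → Subset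
Cylinder l ω = All (λ p → ω (Data.Product.proj₁ p) ≡ Data.Product.proj₂ p) l

data Measurable : Subset → Set₁ where
  cyl   : (l : List (ℕ × Bool)) → Measurable (Cylinder l)
  compl : ∀ {A} → Measurable A → Measurable (λ ω → ¬ A ω)
  ⋃     : (A : ℕ → Subset) → (∀ i → Measurable (A i))
        → Measurable (λ ω → Σ ℕ (λ i → A i ω))
  ext   : ∀ {A B} → Measurable A → (∀ ω → A ω ⇔ B ω) → Measurable B

S : ∀ {σ} → OTerm σ → Closed σ → Subset
S M N ω = (M ^ ω) ⇓ Closed.term N

{-# OPTIONS --safe #-}
-- Reducing M^ω consults ω only when an oracle call is contracted.  Reduce
-- instead M with an arbitrary oracle plugged in, but answer every oracle call
-- by querying the input sequence: then k reduction steps form a finite decision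
-- tree independent of ω, and running it on ω follows M^ω ⟶* … step by step, the
-- two terms differing only in their oracle constants.  The set of ω on which
-- the k-step tree ends in N is a finite union of cylinders, and S_{M,N} is the
-- union of these sets over k.  Whether a leaf equals N is decidable because N is
-- an oracle-free PCF term.
module Submission where

open import Defs
open import Data.Nat using (ℕ; zero; suc)
open import Data.Bool using (Bool; true; false)
open import Data.Empty using (⊥; ⊥-elim)
open import Data.List using (List; []; _∷_)
open import Data.List.Relation.Unary.All using ([]; _∷_)
open import Data.Maybe using (Maybe; just; nothing; maybe′)
open import Data.Maybe.Properties using (just-injective)
open import Data.Product using (Σ; ∃; ∃₂; _×_; _,_; proj₁; proj₂; uncurry)
open import Data.Sum using (_⊎_; inj₁; inj₂)
open import Function using (_∘_)
open import Function.Bundles using (mk⇔)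
open import Relation.Binary.Definitions using (DecidableEquality)
open import Relation.Binary.PropositionalEquality using (_≡_; refl; sym; trans; cong; cong₂)
open import Relation.Nullary using (Dec; yes; no)
open import Relation.Nullary.Decidable using (map′; _×-dec_)
open import Relation.Unary using (Decidable)

variable
  Γ Δ : Ctx
  σ τ : Ty
  ω : Cantor

data Tree (A : Set) : Set where
  leaf : A → Tree A
  ask  : ℕ → (Bool → Tree A) → Tree A

run : ∀ {A} → Tree A → Cantor → A
run (leaf a)  ω = a
run (ask n f) ω = run (f (ω n)) ω

_>>=_ : ∀ {A B} → Tree A → (A → Tree B) → Tree B
leaf a  >>= k = k a
ask n f >>= k = ask n λ b → f b >>= k

run->>= : ∀ {A B} (t : Tree A) (k : A → Tree B) ω → run (t >>= k) ω ≡ run (k (run t ω)) ω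
run->>= (leaf a)  k ω = refl
run->>= (ask n f) k ω = run->>= (f (ω n)) k ω

∅-measurable : Measurable λ _ → ⊥
∅-measurable = ext (compl (cyl [])) λ _ → mk⇔ (λ ¬all → ¬all []) ⊥-elim

∪-measurable : ∀ {A B} → Measurable A → Measurable B → Measurable λ ω → A ω ⊎ B ω
∪-measurable {A} {B} mA mB = ext (⋃ A∨B measurable) λ _ → mk⇔ to from
  where
    A∨B : ℕ → Subset
    A∨B zero    = A
    A∨B (suc _) = B
    measurable : ∀ i → Measurable (A∨B i)
    measurable zero    = mA
    measurable (suc _) = mB
    to : ∀ {ω} → Σ ℕ (λ i → A∨B i ω) → A ω ⊎ B ω
    to (zero , a)  = inj₁ a
    to (suc _ , b) = inj₂ b
    from : ∀ {ω} → A ω ⊎ B ω → Σ ℕ (λ i → A∨B i ω)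
    from (inj₁ a) = zero , a
    from (inj₂ b) = suc zero , b

module _ {A : Set} {P : A → Set} (P? : Decidable P) where

  -- The cylinder l collects the answers along a branch; intersecting with it
  -- directly avoids intersections of measurable sets, which would need
  -- double-negation elimination when written with complements.
  cylinder∩run-measurable : (t : Tree A) (l : List (ℕ × Bool))
                          → Measurable λ ω → Cylinder l ω × P (run t ω)
  cylinder∩run-measurable (leaf a) l with P? a
  ... | yes p = ext (cyl l) λ _ → mk⇔ (_, p) proj₁
  ... | no ¬p = ext ∅-measurable λ _ → mk⇔ ⊥-elim (¬p ∘ proj₂)
  cylinder∩run-measurable (ask n f) l =
    ext (∪-measurable (branch true) (branch false)) λ ω → mk⇔ (merge ω) (split ω)
    where
      Branch : Bool → Subset
      Branch b ω = Cylinder ((n , b) ∷ l) ω × P (run (f b) ω)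
      branch : ∀ b → Measurable (Branch b)
      branch b = cylinder∩run-measurable (f b) ((n , b) ∷ l)
      merge : ∀ ω → Branch true ω ⊎ Branch false ω → Cylinder l ω × P (run (ask n f) ω)
      merge ω (inj₁ (ωn≡b ∷ c , p)) rewrite ωn≡b = c , p
      merge ω (inj₂ (ωn≡b ∷ c , p)) rewrite ωn≡b = c , p
      split : ∀ ω → Cylinder l ω × P (run (ask n f) ω) → Branch true ω ⊎ Branch false ω
      split ω (c , p) with ω n in ωn≡b
      ... | true  = inj₁ (ωn≡b ∷ c , p)
      ... | false = inj₂ (ωn≡b ∷ c , p)

  run-measurable : (t : Tree A) → Measurable λ ω → P (run t ω)
  run-measurable t = ext (cylinder∩run-measurable t []) λ _ → mk⇔ proj₂ ([] ,_)

_≟ₜ_ : DecidableEquality Ty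
nat     ≟ₜ nat       = yes refl
bool    ≟ₜ bool      = yes refl
(σ ⇒ τ) ≟ₜ (σ' ⇒ τ') =
  map′ (uncurry (cong₂ _⇒_)) (λ { refl → refl , refl }) (σ ≟ₜ σ' ×-dec τ ≟ₜ τ')
(σ ⊗ τ) ≟ₜ (σ' ⊗ τ') =
  map′ (uncurry (cong₂ _⊗_)) (λ { refl → refl , refl }) (σ ≟ₜ σ' ×-dec τ ≟ₜ τ')
nat     ≟ₜ bool      = no λ ()
nat     ≟ₜ (_ ⇒ _)   = no λ ()
nat     ≟ₜ (_ ⊗ _)   = no λ ()
bool    ≟ₜ nat       = no λ ()
bool    ≟ₜ (_ ⇒ _)   = no λ ()
bool    ≟ₜ (_ ⊗ _)   = no λ ()
(_ ⇒ _) ≟ₜ nat       = no λ ()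
(_ ⇒ _) ≟ₜ bool      = no λ ()
(_ ⇒ _) ≟ₜ (_ ⊗ _)   = no λ ()
(_ ⊗ _) ≟ₜ nat       = no λ ()
(_ ⊗ _) ≟ₜ bool      = no λ ()
(_ ⊗ _) ≟ₜ (_ ⇒ _)   = no λ ()

_≟ᵥ_ : DecidableEquality (Γ ∋ σ)
here    ≟ᵥ here    = yes refl
here    ≟ᵥ there _ = no λ ()
there _ ≟ᵥ here    = no λ ()
there x ≟ᵥ there y = map′ (cong there) (λ { refl → refl }) (x ≟ᵥ y)

-- Oracle constants have no
-- decidable equality, so terms are only compared against pure ones, by
-- matching the candidate against the head constructor of the pure term.

var? : (V : Tm Γ σ) → Maybe (∃ λ x → V ≡ var x)
var? (var x) = just (x , refl)
var? _       = nothing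

lam? : (V : Tm Γ (σ ⇒ τ)) → Maybe (∃ λ M → V ≡ lam M)
lam? (lam M) = just (M , refl)
lam? _       = nothing

app? : (V : Tm Γ τ) → Maybe (∃ λ σ → ∃₂ λ (M : Tm Γ (σ ⇒ τ)) N → V ≡ app M N)
app? (app M N) = just (_ , M , N , refl)
app? _         = nothing

pair? : (V : Tm Γ (σ ⊗ τ)) → Maybe (∃₂ λ M N → V ≡ pair M N)
pair? (pair M N) = just (M , N , refl)
pair? _          = nothing

fst? : (V : Tm Γ σ) → Maybe (∃ λ τ → ∃ λ (M : Tm Γ (σ ⊗ τ)) → V ≡ fst M)
fst? (fst M) = just (_ , M , refl)
fst? _       = nothing

snd? : (V : Tm Γ τ) → Maybe (∃ λ σ → ∃ λ (M : Tm Γ (σ ⊗ τ)) → V ≡ snd M)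
snd? (snd M) = just (_ , M , refl)
snd? _       = nothing

zer? : (V : Tm Γ nat) → Maybe (V ≡ zer)
zer? zer = just refl
zer? _   = nothing

succ? : (V : Tm Γ nat) → Maybe (∃ λ M → V ≡ succ M)
succ? (succ M) = just (M , refl)
succ? _        = nothing

pred? : (V : Tm Γ nat) → Maybe (∃ λ M → V ≡ pred M)
pred? (pred M) = just (M , refl)
pred? _        = nothing

iszero? : (V : Tm Γ bool) → Maybe (∃ λ M → V ≡ iszero M)
iszero? (iszero M) = just (M , refl)
iszero? _          = nothing

tt? : (V : Tm Γ bool) → Maybe (V ≡ tt)
tt? tt = just refl
tt? _  = nothing

ff? : (V : Tm Γ bool) → Maybe (V ≡ ff)
ff? ff = just refl
ff? _  = nothing

ifte? : (V : Tm Γ σ) → Maybe (∃ λ B → ∃₂ λ M N → V ≡ ifte B M N)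
ifte? (ifte B M N) = just (B , M , N , refl)
ifte? _            = nothing

fix? : (V : Tm Γ σ) → Maybe (∃ λ M → V ≡ fix M)
fix? (fix M) = just (M , refl)
fix? _       = nothing

decide-by-match : {A : Tm Γ σ → Set} (V : Tm Γ σ) {N : Tm Γ σ}
                  (match : (V : Tm Γ σ) → Maybe (A V)) {a : A N}
                → match N ≡ just a → (A V → Dec (V ≡ N)) → Dec (V ≡ N)
decide-by-match V match matchN≡just decide with match V in matchV
... | just x  = decide x
... | nothing = no λ { refl → just≢nothing (trans (sym matchN≡just) matchV) }
  where
    just≢nothing : ∀ {A : Set} {a : A} → just a ≡ nothing → ⊥
    just≢nothing ()

mutual
  ≟-pure : (V : Tm Γ σ) {N : Tm Γ σ} → Pure N → Dec (V ≡ N)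
  ≟-pure V (var y) = decide-by-match V var? refl λ { (x , refl) →
    map′ (cong var) (λ { refl → refl }) (x ≟ᵥ y) }
  ≟-pure V (lam p) = decide-by-match V lam? refl λ { (M , refl) →
    map′ (cong lam) (λ { refl → refl }) (≟-pure M p) }
  ≟-pure V (app p q) = decide-by-match V app? refl λ { (_ , M , N , refl) → ≟-app M N p q }
  ≟-pure V (pair p q) = decide-by-match V pair? refl λ { (M , N , refl) →
    map′ (uncurry (cong₂ pair)) (λ { refl → refl , refl }) (≟-pure M p ×-dec ≟-pure N q) }
  ≟-pure V (fst p) = decide-by-match V fst? refl λ { (_ , M , refl) → ≟-fst M p }
  ≟-pure V (snd p) = decide-by-match V snd? refl λ { (_ , M , refl) → ≟-snd M p }
  ≟-pure V zer = decide-by-match V zer? refl λ { refl → yes refl }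
  ≟-pure V (succ p) = decide-by-match V succ? refl λ { (M , refl) →
    map′ (cong succ) (λ { refl → refl }) (≟-pure M p) }
  ≟-pure V (pred p) = decide-by-match V pred? refl λ { (M , refl) →
    map′ (cong pred) (λ { refl → refl }) (≟-pure M p) }
  ≟-pure V (iszero p) = decide-by-match V iszero? refl λ { (M , refl) →
    map′ (cong iszero) (λ { refl → refl }) (≟-pure M p) }
  ≟-pure V tt = decide-by-match V tt? refl λ { refl → yes refl }
  ≟-pure V ff = decide-by-match V ff? refl λ { refl → yes refl }
  ≟-pure V (ifte p q r) = decide-by-match V ifte? refl λ { (B , M , N , refl) →
    map′ (λ { (refl , refl , refl) → refl }) (λ { refl → refl , refl , refl })
         (≟-pure B p ×-dec ≟-pure M q ×-dec ≟-pure N r) }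
  ≟-pure V (fix p) = decide-by-match V fix? refl λ { (M , refl) →
    map′ (cong fix) (λ { refl → refl }) (≟-pure M p) }

  ≟-app : ∀ {ρ σ} (M : Tm Γ (ρ ⇒ τ)) N {G : Tm Γ (σ ⇒ τ)} {B}
        → Pure G → Pure B → Dec (app M N ≡ app G B)
  ≟-app {ρ = ρ} {σ = σ} M N p q with ρ ≟ₜ σ
  ... | no ρ≢σ = no λ { refl → ρ≢σ refl }
  ... | yes refl =
    map′ (uncurry (cong₂ app)) (λ { refl → refl , refl }) (≟-pure M p ×-dec ≟-pure N q)

  ≟-fst : ∀ {ρ τ} (M : Tm Γ (σ ⊗ ρ)) {G : Tm Γ (σ ⊗ τ)} → Pure G → Dec (fst M ≡ fst G)
  ≟-fst {ρ = ρ} {τ = τ} M p with ρ ≟ₜ τ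
  ... | no ρ≢τ = no λ { refl → ρ≢τ refl }
  ... | yes refl = map′ (cong fst) (λ { refl → refl }) (≟-pure M p)

  ≟-snd : ∀ {ρ σ} (M : Tm Γ (ρ ⊗ τ)) {G : Tm Γ (σ ⊗ τ)} → Pure G → Dec (snd M ≡ snd G)
  ≟-snd {ρ = ρ} {σ = σ} M p with ρ ≟ₜ σ
  ... | no ρ≢σ = no λ { refl → ρ≢σ refl }
  ... | yes refl = map′ (cong snd) (λ { refl → refl }) (≟-pure M p)

data Instance (ω : Cantor) {Γ : Ctx} : ∀ {σ} → Tm Γ σ → Tm Γ σ → Set

infix 4 Instance
syntax Instance ω T T' = T ≈[ ω ] T'

data Instance ω {Γ} where
  var    : (x : Γ ∋ σ) → var x ≈[ ω ] var x
  lam    : {M M' : Tm (σ ∷ Γ) τ} → M ≈[ ω ] M' → lam M ≈[ ω ] lam M'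
  app    : {M M' : Tm Γ (σ ⇒ τ)} {N N' : Tm Γ σ} → M ≈[ ω ] M' → N ≈[ ω ] N'
         → app M N ≈[ ω ] app M' N'
  pair   : {M M' : Tm Γ σ} {N N' : Tm Γ τ} → M ≈[ ω ] M' → N ≈[ ω ] N'
         → pair M N ≈[ ω ] pair M' N'
  fst    : {M M' : Tm Γ (σ ⊗ τ)} → M ≈[ ω ] M' → fst M ≈[ ω ] fst M'
  snd    : {M M' : Tm Γ (σ ⊗ τ)} → M ≈[ ω ] M' → snd M ≈[ ω ] snd M'
  zer    : zer ≈[ ω ] zer
  succ   : {M M' : Tm Γ nat} → M ≈[ ω ] M' → succ M ≈[ ω ] succ M'
  pred   : {M M' : Tm Γ nat} → M ≈[ ω ] M' → pred M ≈[ ω ] pred M'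
  iszero : {M M' : Tm Γ nat} → M ≈[ ω ] M' → iszero M ≈[ ω ] iszero M'
  tt     : tt ≈[ ω ] tt
  ff     : ff ≈[ ω ] ff
  ifte   : {B B' : Tm Γ bool} {M M' N N' : Tm Γ σ}
         → B ≈[ ω ] B' → M ≈[ ω ] M' → N ≈[ ω ] N'
         → ifte B M N ≈[ ω ] ifte B' M' N'
  fix    : {M M' : Tm Γ (σ ⇒ σ)} → M ≈[ ω ] M' → fix M ≈[ ω ] fix M'
  oracle : ∀ {α} → ⟪ α ⟫ ≈[ ω ] ⟪ ω ⟫

InstanceSub : Cantor → Sub Γ Δ → Sub Γ Δ → Set
InstanceSub {Γ} ω s s' = ∀ {σ} (x : Γ ∋ σ) → s x ≈[ ω ] s' x

infix 4 InstanceSub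
syntax InstanceSub ω s s' = s ≈ˢ[ ω ] s'

≈-rename : (ρ : Ren Γ Δ) {T T' : Tm Γ σ} → T ≈[ ω ] T' → rename ρ T ≈[ ω ] rename ρ T'
≈-rename ρ (var x)      = var (ρ x)
≈-rename ρ (lam r)      = lam (≈-rename (extR ρ) r)
≈-rename ρ (app r s)    = app (≈-rename ρ r) (≈-rename ρ s)
≈-rename ρ (pair r s)   = pair (≈-rename ρ r) (≈-rename ρ s)
≈-rename ρ (fst r)      = fst (≈-rename ρ r)
≈-rename ρ (snd r)      = snd (≈-rename ρ r)
≈-rename ρ zer          = zer
≈-rename ρ (succ r)     = succ (≈-rename ρ r)
≈-rename ρ (pred r)     = pred (≈-rename ρ r)
≈-rename ρ (iszero r)   = iszero (≈-rename ρ r)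
≈-rename ρ tt           = tt
≈-rename ρ ff           = ff
≈-rename ρ (ifte r s t) = ifte (≈-rename ρ r) (≈-rename ρ s) (≈-rename ρ t)
≈-rename ρ (fix r)      = fix (≈-rename ρ r)
≈-rename ρ oracle       = oracle

≈ˢ-ext : {s s' : Sub Γ Δ} → s ≈ˢ[ ω ] s' → extS {τ = τ} s ≈ˢ[ ω ] extS s'
≈ˢ-ext rs here      = var here
≈ˢ-ext rs (there x) = ≈-rename there (rs x)

≈-subst : {s s' : Sub Γ Δ} → s ≈ˢ[ ω ] s'
        → {T T' : Tm Γ σ} → T ≈[ ω ] T' → subst s T ≈[ ω ] subst s' T'
≈-subst rs (var x)      = rs x
≈-subst rs (lam r)      = lam (≈-subst (≈ˢ-ext rs) r)
≈-subst rs (app r s)    = app (≈-subst rs r) (≈-subst rs s)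
≈-subst rs (pair r s)   = pair (≈-subst rs r) (≈-subst rs s)
≈-subst rs (fst r)      = fst (≈-subst rs r)
≈-subst rs (snd r)      = snd (≈-subst rs r)
≈-subst rs zer          = zer
≈-subst rs (succ r)     = succ (≈-subst rs r)
≈-subst rs (pred r)     = pred (≈-subst rs r)
≈-subst rs (iszero r)   = iszero (≈-subst rs r)
≈-subst rs tt           = tt
≈-subst rs ff           = ff
≈-subst rs (ifte r s t) = ifte (≈-subst rs r) (≈-subst rs s) (≈-subst rs t)
≈-subst rs (fix r)      = fix (≈-subst rs r)
≈-subst rs oracle       = oracle

≈ˢ-single : {N N' : Tm Γ τ} → N ≈[ ω ] N' → single N ≈ˢ[ ω ] single N'
≈ˢ-single r here      = r
≈ˢ-single r (there x) = var x

≈-[] : {M M' : Tm (τ ∷ Γ) σ} {N N' : Tm Γ τ}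
     → M ≈[ ω ] M' → N ≈[ ω ] N' → M [ N ] ≈[ ω ] M' [ N' ]
≈-[] r s = ≈-subst (≈ˢ-single s) r

≈-refl : {M : Tm Γ σ} → Pure M → M ≈[ ω ] M
≈-refl (var x)      = var x
≈-refl (lam p)      = lam (≈-refl p)
≈-refl (app p q)    = app (≈-refl p) (≈-refl q)
≈-refl (pair p q)   = pair (≈-refl p) (≈-refl q)
≈-refl (fst p)      = fst (≈-refl p)
≈-refl (snd p)      = snd (≈-refl p)
≈-refl zer          = zer
≈-refl (succ p)     = succ (≈-refl p)
≈-refl (pred p)     = pred (≈-refl p)
≈-refl (iszero p)   = iszero (≈-refl p)
≈-refl tt           = tt
≈-refl ff           = ff
≈-refl (ifte p q r) = ifte (≈-refl p) (≈-refl q) (≈-refl r)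
≈-refl (fix p)      = fix (≈-refl p)

≈-pureˡ : {M V : Tm Γ σ} → Pure M → M ≈[ ω ] V → V ≡ M
≈-pureˡ (var x)      (var x)      = refl
≈-pureˡ (lam p)      (lam r)      = cong lam (≈-pureˡ p r)
≈-pureˡ (app p q)    (app r s)    = cong₂ app (≈-pureˡ p r) (≈-pureˡ q s)
≈-pureˡ (pair p q)   (pair r s)   = cong₂ pair (≈-pureˡ p r) (≈-pureˡ q s)
≈-pureˡ (fst p)      (fst r)      = cong fst (≈-pureˡ p r)
≈-pureˡ (snd p)      (snd r)      = cong snd (≈-pureˡ p r)
≈-pureˡ zer          zer          = refl
≈-pureˡ (succ p)     (succ r)     = cong succ (≈-pureˡ p r)
≈-pureˡ (pred p)     (pred r)     = cong pred (≈-pureˡ p r)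
≈-pureˡ (iszero p)   (iszero r)   = cong iszero (≈-pureˡ p r)
≈-pureˡ tt           tt           = refl
≈-pureˡ ff           ff           = refl
≈-pureˡ (ifte p q u) (ifte r s t) rewrite ≈-pureˡ p r | ≈-pureˡ q s | ≈-pureˡ u t = refl
≈-pureˡ (fix p)      (fix r)      = cong fix (≈-pureˡ p r)

≈-pureʳ : {V N : Tm Γ σ} → Pure N → V ≈[ ω ] N → V ≡ N
≈-pureʳ (var x)      (var x)      = refl
≈-pureʳ (lam p)      (lam r)      = cong lam (≈-pureʳ p r)
≈-pureʳ (app p q)    (app r s)    = cong₂ app (≈-pureʳ p r) (≈-pureʳ q s)
≈-pureʳ (pair p q)   (pair r s)   = cong₂ pair (≈-pureʳ p r) (≈-pureʳ q s)
≈-pureʳ (fst p)      (fst r)      = cong fst (≈-pureʳ p r)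
≈-pureʳ (snd p)      (snd r)      = cong snd (≈-pureʳ p r)
≈-pureʳ zer          zer          = refl
≈-pureʳ (succ p)     (succ r)     = cong succ (≈-pureʳ p r)
≈-pureʳ (pred p)     (pred r)     = cong pred (≈-pureʳ p r)
≈-pureʳ (iszero p)   (iszero r)   = cong iszero (≈-pureʳ p r)
≈-pureʳ tt           tt           = refl
≈-pureʳ ff           ff           = refl
≈-pureʳ (ifte p q u) (ifte r s t) rewrite ≈-pureʳ p r | ≈-pureʳ q s | ≈-pureʳ u t = refl
≈-pureʳ (fix p)      (fix r)      = cong fix (≈-pureʳ p r)

^-≈ : ∀ {α} (M : OTerm σ) → M ^ α ≈[ ω ] M ^ ω
^-≈ M = ≈-[] (≈-refl (OTerm.pure M)) oracle

num-pure : ∀ n → Pure {Γ} (num n)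
num-pure zero    = zer
num-pure (suc n) = succ (num-pure n)

num-IsNum : ∀ n → IsNum {Γ} (num n)
num-IsNum zero    = zer
num-IsNum (suc n) = succ (num-IsNum n)

IsNum⇒num : {V : Tm Γ nat} → IsNum V → ∃ λ n → V ≡ num n
IsNum⇒num zer = zero , refl
IsNum⇒num (succ v) with IsNum⇒num v
... | n , refl = suc n , refl

bconst-pure : ∀ b → Pure {Γ} (bconst b)
bconst-pure true  = tt
bconst-pure false = ff

numeral? : (V : Tm Γ nat) → Maybe (∃ λ n → V ≡ num n)
numeral? zer      = just (zero , refl)
numeral? (succ V) = Data.Maybe.map (λ (n , V≡n) → suc n , cong succ V≡n) (numeral? V)
numeral? _        = nothing

numeral?-num : ∀ n → numeral? {Γ} (num n) ≡ just (n , refl)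
numeral?-num zero = refl
numeral?-num {Γ} (suc n) rewrite numeral?-num {Γ} n = refl

Step : Ty → Set
Step σ = Tree (Maybe (Tm [] σ))

resume : (Tm [] σ → Tm [] τ) → Step τ → Maybe (Tm [] σ) → Step τ
resume E c (just M) = leaf (just (E M))
resume E c nothing  = c

-- Reduce inside the strict position of E if possible, else fall back to c.
-- Values never reduce, so trying the position first agrees with _⟶_.
stepUnder : (Tm [] σ → Tm [] τ) → Step σ → Step τ → Step τ
stepUnder E t c = t >>= resume E c

askNumeral : Tm [] nat → Step bool
askNumeral N = maybe′ (λ (n , _) → ask n λ b → leaf (just (bconst b)))
                      (leaf nothing) (numeral? N)

whenNumeral : Tm [] nat → Tm [] τ → Maybe (Tm [] τ)
whenNumeral V U = maybe′ (λ _ → just U) nothing (numeral? V)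

contractApp : Tm [] (σ ⇒ τ) → Tm [] σ → Step σ → Step τ
contractApp (lam M) N _     = leaf (just (M [ N ]))
contractApp ⟪ α ⟫   N stepN = stepUnder (app ⟪ α ⟫) stepN (askNumeral N)
contractApp _       _ _     = leaf nothing

contractFst : Tm [] (σ ⊗ τ) → Maybe (Tm [] σ)
contractFst (pair M _) = just M
contractFst _          = nothing

contractSnd : Tm [] (σ ⊗ τ) → Maybe (Tm [] τ)
contractSnd (pair _ N) = just N
contractSnd _          = nothing

contractPred : Tm [] nat → Maybe (Tm [] nat)
contractPred zer      = just zer
contractPred (succ V) = whenNumeral V V
contractPred _        = nothing

contractIsZero : Tm [] nat → Maybe (Tm [] bool)
contractIsZero zer      = just tt
contractIsZero (succ V) = whenNumeral V ff
contractIsZero _        = nothing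

contractIf : Tm [] bool → Tm [] σ → Tm [] σ → Maybe (Tm [] σ)
contractIf tt M _ = just M
contractIf ff _ N = just N
contractIf _  _ _ = nothing

stepTree : Tm [] σ → Step σ
stepTree (app M N)    = stepUnder (λ M' → app M' N) (stepTree M) (contractApp M N (stepTree N))
stepTree (fst M)      = stepUnder fst (stepTree M) (leaf (contractFst M))
stepTree (snd M)      = stepUnder snd (stepTree M) (leaf (contractSnd M))
stepTree (succ M)     = stepUnder succ (stepTree M) (leaf nothing)
stepTree (pred M)     = stepUnder pred (stepTree M) (leaf (contractPred M))
stepTree (iszero M)   = stepUnder iszero (stepTree M) (leaf (contractIsZero M))
stepTree (ifte B M N) = stepUnder (λ B' → ifte B' M N) (stepTree B) (leaf (contractIf B M N))
stepTree (fix M)      = leaf (just (app M (fix M)))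
stepTree _            = leaf nothing

run-stepUnder-just : {E : Tm [] σ → Tm [] τ} (t : Step σ) {c : Step τ} {M : Tm [] σ}
                   → run t ω ≡ just M → run (stepUnder E t c) ω ≡ just (E M)
run-stepUnder-just {ω = ω} {E = E} t {c} e rewrite run->>= t (resume E c) ω | e = refl

run-stepUnder-inv : {E : Tm [] σ → Tm [] τ} (t : Step σ) {c : Step τ} {U : Tm [] τ}
                  → run (stepUnder E t c) ω ≡ just U
                  → (∃ λ M → run t ω ≡ just M × E M ≡ U) ⊎ run c ω ≡ just U
run-stepUnder-inv {ω = ω} {E = E} t {c} e rewrite run->>= t (resume E c) ω with run t ω
... | just M  = inj₁ (M , refl , just-injective e)
... | nothing = inj₂ e

stepTree-num : ∀ n → stepTree (num n) ≡ leaf nothing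
stepTree-num zero    = refl
stepTree-num (suc n) rewrite stepTree-num n = refl

run-oracle-num : ∀ {α} n → run (stepTree (app ⟪ α ⟫ (num n))) ω ≡ just (bconst (ω n))
run-oracle-num n rewrite stepTree-num n | numeral?-num {[]} n = refl

run-succ-num : {E : Tm [] nat → Tm [] τ} {U : Tm [] τ} → ∀ n
             → run (stepUnder E (stepTree (num (suc n))) (leaf (whenNumeral (num n) U))) ω ≡ just U
run-succ-num n rewrite stepTree-num (suc n) | numeral?-num {[]} n = refl

Reduct : Cantor → Tm [] σ → Tm [] σ → Set
Reduct ω T' U = ∃ λ U' → T' ⟶ U' × U ≈[ ω ] U'

stepUnder-sound : {E E' : Tm [] σ → Tm [] τ} {M' : Tm [] σ} (t : Step σ) {c : Step τ}
                → ∀ {U} → run (stepUnder E t c) ω ≡ just U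
                → (∀ {X Y} → X ⟶ Y → E' X ⟶ E' Y)
                → (∀ {X X'} → X ≈[ ω ] X' → E X ≈[ ω ] E' X')
                → (∀ {V} → run t ω ≡ just V → Reduct ω M' V)
                → (∀ {V} → run c ω ≡ just V → Reduct ω (E' M') V)
                → Reduct ω (E' M') U
stepUnder-sound {E' = E'} t e ξ E≈E' sound-t sound-c with run-stepUnder-inv t e
... | inj₂ e₁ = sound-c e₁
... | inj₁ (_ , e₁ , refl) with sound-t e₁
...   | V' , s , r = E' V' , ξ s , E≈E' r

askNumeral-sound : {N N' : Tm [] nat} → N ≈[ ω ] N'
                 → ∀ {U} → run (askNumeral N) ω ≡ just U → Reduct ω (app ⟪ ω ⟫ N') U
askNumeral-sound {ω = ω} {N = N} r e with numeral? N
... | nothing with () ← e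
... | just (n , refl) with refl ← e | refl ← ≈-pureˡ (num-pure n) r =
  bconst (ω n) , oracle , ≈-refl (bconst-pure (ω n))

whenNumeral-sound : {V V' : Tm [] nat} {U U' : Tm [] τ}
                  → V ≈[ ω ] V' → whenNumeral V U ≡ just U' → U' ≡ U × IsNum V'
whenNumeral-sound {V = V} r e with numeral? V
... | nothing with () ← e
... | just (n , refl) with refl ← e | refl ← ≈-pureˡ (num-pure n) r = refl , num-IsNum n

contractFst-sound : {M M' : Tm [] (σ ⊗ τ)} → M ≈[ ω ] M'
                  → ∀ {U} → contractFst M ≡ just U → Reduct ω (fst M') U
contractFst-sound (pair r _)   refl = _ , fst-β , r
contractFst-sound (var ())
contractFst-sound (app _ _)    ()
contractFst-sound (fst _)      ()
contractFst-sound (snd _)      ()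
contractFst-sound (ifte _ _ _) ()
contractFst-sound (fix _)      ()

contractSnd-sound : {M M' : Tm [] (σ ⊗ τ)} → M ≈[ ω ] M'
                  → ∀ {U} → contractSnd M ≡ just U → Reduct ω (snd M') U
contractSnd-sound (pair _ s)   refl = _ , snd-β , s
contractSnd-sound (var ())
contractSnd-sound (app _ _)    ()
contractSnd-sound (fst _)      ()
contractSnd-sound (snd _)      ()
contractSnd-sound (ifte _ _ _) ()
contractSnd-sound (fix _)      ()

contractPred-sound : {M M' : Tm [] nat} → M ≈[ ω ] M'
                   → ∀ {U} → contractPred M ≡ just U → Reduct ω (pred M') U
contractPred-sound zer refl = zer , pred-0 , zer
contractPred-sound (succ r) e with whenNumeral-sound r e
... | refl , v = _ , pred-s v , r
contractPred-sound (var ())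
contractPred-sound (app _ _)    ()
contractPred-sound (fst _)      ()
contractPred-sound (snd _)      ()
contractPred-sound (pred _)     ()
contractPred-sound (ifte _ _ _) ()
contractPred-sound (fix _)      ()

contractIsZero-sound : {M M' : Tm [] nat} → M ≈[ ω ] M'
                     → ∀ {U} → contractIsZero M ≡ just U → Reduct ω (iszero M') U
contractIsZero-sound zer refl = tt , isz-0 , tt
contractIsZero-sound (succ r) e with whenNumeral-sound r e
... | refl , v = ff , isz-s v , ff
contractIsZero-sound (var ())
contractIsZero-sound (app _ _)    ()
contractIsZero-sound (fst _)      ()
contractIsZero-sound (snd _)      ()
contractIsZero-sound (pred _)     ()
contractIsZero-sound (ifte _ _ _) ()
contractIsZero-sound (fix _)      ()

contractIf-sound : {B B' : Tm [] bool} {M M' N N' : Tm [] σ}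
                 → B ≈[ ω ] B' → M ≈[ ω ] M' → N ≈[ ω ] N'
                 → ∀ {U} → contractIf B M N ≡ just U → Reduct ω (ifte B' M' N') U
contractIf-sound tt q _ refl = _ , if-t , q
contractIf-sound ff _ s refl = _ , if-f , s
contractIf-sound (var ()) _ _
contractIf-sound (app _ _)    _ _ ()
contractIf-sound (fst _)      _ _ ()
contractIf-sound (snd _)      _ _ ()
contractIf-sound (iszero _)   _ _ ()
contractIf-sound (ifte _ _ _) _ _ ()
contractIf-sound (fix _)      _ _ ()

mutual
  stepTree-sound : {T T' : Tm [] σ} → T ≈[ ω ] T'
                 → ∀ {U} → run (stepTree T) ω ≡ just U → Reduct ω T' U
  stepTree-sound (app {M = M} r s) e =
    stepUnder-sound (stepTree M) e ξ-app (λ r' → app r' s) (stepTree-sound r) (contractApp-sound r s)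
  stepTree-sound (fst {M = M} r) e =
    stepUnder-sound (stepTree M) e ξ-fst fst (stepTree-sound r) (contractFst-sound r)
  stepTree-sound (snd {M = M} r) e =
    stepUnder-sound (stepTree M) e ξ-snd snd (stepTree-sound r) (contractSnd-sound r)
  stepTree-sound (succ {M = M} r) e =
    stepUnder-sound (stepTree M) e ξ-succ succ (stepTree-sound r) λ ()
  stepTree-sound (pred {M = M} r) e =
    stepUnder-sound (stepTree M) e ξ-pred pred (stepTree-sound r) (contractPred-sound r)
  stepTree-sound (iszero {M = M} r) e =
    stepUnder-sound (stepTree M) e ξ-isz iszero (stepTree-sound r) (contractIsZero-sound r)
  stepTree-sound (ifte {B = B} r q s) e =
    stepUnder-sound (stepTree B) e ξ-if (λ r' → ifte r' q s) (stepTree-sound r) (contractIf-sound r q s)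
  stepTree-sound (fix r) refl = _ , fix-β , app r (fix r)
  stepTree-sound (var ())
  stepTree-sound (lam _)    ()
  stepTree-sound (pair _ _) ()
  stepTree-sound zer        ()
  stepTree-sound tt         ()
  stepTree-sound ff         ()
  stepTree-sound oracle     ()

  contractApp-sound : {M M' : Tm [] (σ ⇒ τ)} {N N' : Tm [] σ}
                    → M ≈[ ω ] M' → N ≈[ ω ] N'
                    → ∀ {U} → run (contractApp M N (stepTree N)) ω ≡ just U
                    → Reduct ω (app M' N') U
  contractApp-sound (lam r) s refl = _ , β , ≈-[] r s
  contractApp-sound {N = N} oracle s e =
    stepUnder-sound (stepTree N) e ξ-oracle (app oracle) (stepTree-sound s) (askNumeral-sound s)
  contractApp-sound (var ())
  contractApp-sound (app _ _)    _ ()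
  contractApp-sound (fst _)      _ ()
  contractApp-sound (snd _)      _ ()
  contractApp-sound (ifte _ _ _) _ ()
  contractApp-sound (fix _)      _ ()

TreeReduct : Cantor → Tm [] σ → Tm [] σ → Set
TreeReduct ω T U' = ∃ λ U → run (stepTree T) ω ≡ just U × U ≈[ ω ] U'

stepUnder-complete : {E E' : Tm [] σ → Tm [] τ} (t : Step σ) {c : Step τ} {M'' : Tm [] σ}
                   → (∀ {X X'} → X ≈[ ω ] X' → E X ≈[ ω ] E' X')
                   → (∃ λ M → run t ω ≡ just M × M ≈[ ω ] M'')
                   → ∃ λ U → run (stepUnder E t c) ω ≡ just U × U ≈[ ω ] E' M''
stepUnder-complete {E = E} t E≈E' (M , e , r) = E M , run-stepUnder-just t e , E≈E' r

stepTree-complete : {T T' U' : Tm [] σ} → T ≈[ ω ] T' → T' ⟶ U' → TreeReduct ω T U'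
stepTree-complete (app (lam r) s) β = _ , refl , ≈-[] r s
stepTree-complete (app {M = M} r s) (ξ-app st) =
  stepUnder-complete (stepTree M) (λ r' → app r' s) (stepTree-complete r st)
stepTree-complete {ω = ω} (app oracle s) (oracle {n = n}) with refl ← ≈-pureʳ (num-pure n) s =
  bconst (ω n) , run-oracle-num n , ≈-refl (bconst-pure (ω n))
stepTree-complete (app {N = N} oracle s) (ξ-oracle st) =
  stepUnder-complete (stepTree N) (app oracle) (stepTree-complete s st)
stepTree-complete (fst (pair r _)) fst-β = _ , refl , r
stepTree-complete (fst {M = M} r) (ξ-fst st) = stepUnder-complete (stepTree M) fst (stepTree-complete r st)
stepTree-complete (snd (pair _ s)) snd-β = _ , refl , s
stepTree-complete (snd {M = M} r) (ξ-snd st) = stepUnder-complete (stepTree M) snd (stepTree-complete r st)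
stepTree-complete (succ {M = M} r) (ξ-succ st) = stepUnder-complete (stepTree M) succ (stepTree-complete r st)
stepTree-complete (pred zer) pred-0 = zer , refl , zer
stepTree-complete (pred (succ r)) (pred-s v) with IsNum⇒num v
... | n , refl with refl ← ≈-pureʳ (num-pure n) r = num n , run-succ-num n , r
stepTree-complete (pred {M = M} r) (ξ-pred st) = stepUnder-complete (stepTree M) pred (stepTree-complete r st)
stepTree-complete (iszero zer) isz-0 = tt , refl , tt
stepTree-complete (iszero (succ r)) (isz-s v) with IsNum⇒num v
... | n , refl with refl ← ≈-pureʳ (num-pure n) r = ff , run-succ-num n , ff
stepTree-complete (iszero {M = M} r) (ξ-isz st) =
  stepUnder-complete (stepTree M) iszero (stepTree-complete r st)
stepTree-complete (ifte tt q _) if-t = _ , refl , q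
stepTree-complete (ifte ff _ s) if-f = _ , refl , s
stepTree-complete (ifte {B = B} r q s) (ξ-if st) =
  stepUnder-complete (stepTree B) (λ r' → ifte r' q s) (stepTree-complete r st)
stepTree-complete (fix r) fix-β = _ , refl , app r (fix r)

iterate : ℕ → Tm [] σ → Tree (Tm [] σ)
iterate zero    T = leaf T
iterate (suc k) T = stepTree T >>= maybe′ (iterate k) (leaf T)

run-iterate-suc : ∀ k (T : Tm [] σ)
                → run (iterate (suc k) T) ω ≡ maybe′ (λ U → run (iterate k U) ω) T (run (stepTree T) ω)
run-iterate-suc {ω = ω} k T rewrite run->>= (stepTree T) (maybe′ (iterate k) (leaf T)) ω
  with run (stepTree T) ω
... | just _  = refl
... | nothing = refl

length : {M N : Tm Γ σ} → M ⟶* N → ℕ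
length done       = zero
length (step _ d) = suc (length d)

iterate-complete : {T T' V' : Tm [] σ} → T ≈[ ω ] T'
                 → (d : T' ⟶* V') → run (iterate (length d) T) ω ≈[ ω ] V'
iterate-complete r done = r
iterate-complete {ω = ω} {T = T} r (step s d) with stepTree-complete r s
... | U , e , rU rewrite run-iterate-suc {ω = ω} (length d) T | e = iterate-complete rU d

iterate-sound : {T T' : Tm [] σ} → T ≈[ ω ] T'
              → ∀ k → ∃ λ V' → T' ⟶* V' × run (iterate k T) ω ≈[ ω ] V'
iterate-sound r zero = _ , done , r
iterate-sound {ω = ω} {T = T} r (suc k) rewrite run-iterate-suc {ω = ω} k T
  with run (stepTree T) ω in e
... | nothing = _ , done , r
... | just U with stepTree-sound r e
...   | U' , s , rU with iterate-sound rU k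
...     | V' , d , rV = V' , step s d , rV

reduces⇒reached : {T T' V : Tm [] σ} → T ≈[ ω ] T' → Pure V
                → (d : T' ⟶* V) → run (iterate (length d) T) ω ≡ V
reduces⇒reached r p d = ≈-pureʳ p (iterate-complete r d)

reached⇒reduces : ∀ {k} {T T' V : Tm [] σ} → T ≈[ ω ] T' → Pure V
                → run (iterate k T) ω ≡ V → T' ⟶* V
reached⇒reduces {k = k} r p refl with iterate-sound r k
... | V' , d , rV with refl ← ≈-pureˡ p rV = d

lemma5 : ∀ {σ} (M : OTerm σ) (N : Closed σ) → NormalForm (Closed.term N) → Measurable (S M N)
lemma5 M (closed N pureN) nf =
  ext (⋃ (λ k ω → run (iterate k (M ^ ω₀)) ω ≡ N)
         λ k → run-measurable (λ V → ≟-pure V pureN) (iterate k (M ^ ω₀)))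
      λ _ → mk⇔ (λ (k , e) → reached⇒reduces {k = k} (^-≈ M) pureN e , nf)
                (λ (d , _) → length d , reduces⇒reached (^-≈ M) pureN d)
  where
    ω₀ : Cantor
    ω₀ _ = false
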